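{- For every integer $n>3$, there are at least two distinct sequences of legal moves in the Zeckendorf Game that transform the initial multiset $\{F_1^n\}$ into the Zeckendorf decomposition of $n$.
   Context: Fibonacci numbers are indexed as $F_1=1$, $F_2=2$, $F_{i+1}=F_i+F_{i-1}$. The Zeckendorf decomposition of $n$ is its unique representation as a sum of distinct, pairwise non-adjacent Fibonacci numbers in this indexing. The Zeckendorf Game on $n$: the state is an unordered multiset of Fibonacci numbers summing to $n$, initially $n$ copies of $F_1$; a legal move is one of: (1) replace $F_{i-1},F_i$ by $F_{i+1}$; (2a) replace $F_1,F_1$ by $F_2$; (2b) replace $F_2,F_2$ by $F_1,F_3$; (2c) for $i\ge3$, replace $F_i,F_i$ by $F_{i-2},F_{i+1}$. -}

module Defs where

open import Data.Nat using (ℕ; zero; suc; _+_; _<_; _≤_)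
open import Data.List using (List; []; _∷_; replicate; length)
open import Data.List.Relation.Binary.Permutation.Propositional using (_↭_)
open import Data.Product using (_×_; ∃-syntax)
open import Data.Sum using (_⊎_)
open import Relation.Nullary using (¬_)
open import Relation.Binary.PropositionalEquality using (_≡_)
open import Data.List.Relation.Binary.Pointwise using (Pointwise)

-- Fibonacci numbers with F 1 = 1, F 2 = 2, F (i+1) = F i + F (i-1).
-- (F 0 = 1 is an unused auxiliary value.)
F : ℕ → ℕ
F 0 = 1
F 1 = 1
F (suc (suc i)) = F (suc i) + F i

-- A game state is a multiset of Fibonacci numbers, represented by the list
-- of their indices (each index ≥ 1); multisets are lists up to permutation _↭_.
State : Set
State = List ℕ

sumF : State → ℕ
sumF [] = 0
sumF (i ∷ s) = F i + sumF s

data Move : State → State → Set where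
  -- (1) F_{i-1}, F_i  ↦  F_{i+1}   (i ≥ 2)
  add  : ∀ {s t} i rest → s ↭ (i ∷ suc i ∷ rest) → t ↭ (suc (suc i) ∷ rest) →
         1 ≤ i → Move s t
  m2a  : ∀ {s t} rest → s ↭ (1 ∷ 1 ∷ rest) → t ↭ (2 ∷ rest) → Move s t
  m2b  : ∀ {s t} rest → s ↭ (2 ∷ 2 ∷ rest) → t ↭ (1 ∷ 3 ∷ rest) → Move s t
  -- (2c) F_i, F_i ↦ F_{i-2}, F_{i+1}   (i ≥ 3)
  m2c  : ∀ {s t} i rest → s ↭ (suc (suc i) ∷ suc (suc i) ∷ rest) →
         t ↭ (i ∷ suc (suc (suc i)) ∷ rest) → 1 ≤ i → Move s t

data NonAdjDesc : List ℕ → Set where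
  []  : NonAdjDesc []
  [_] : ∀ {i} → 1 ≤ i → NonAdjDesc (i ∷ [])
  _∷_ : ∀ {i j rest} → suc j < i → NonAdjDesc (j ∷ rest) → NonAdjDesc (i ∷ j ∷ rest)

IsZeckendorf : State → ℕ → Set
IsZeckendorf z n = NonAdjDesc z × sumF z ≡ n

data Chain : List State → Set where
  one  : ∀ s → Chain (s ∷ [])
  step : ∀ {s t rest} → Move s t → Chain (t ∷ rest) → Chain (s ∷ t ∷ rest)

data Head (P : State → Set) : List State → Set where
  here : ∀ {s rest} → P s → Head P (s ∷ rest)

data Last (P : State → Set) : List State → Set where
  last : ∀ {s} → P s → Last P (s ∷ [])
  more : ∀ {s rest} → Last P rest → Last P (s ∷ rest)

Game : ℕ → List State → Set
Game n g = Chain g × Head (λ s → s ↭ replicate n 1) g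
                   × Last (λ s → ∃[ z ] (IsZeckendorf z n × s ↭ z)) g

SameGame : List State → List State → Set
SameGame = Pointwise _↭_

module Submission where

-- Write n = 4 + k and R for k copies of F₁.  From F₁F₁F₁F₁R the move (2a)
-- gives F₂F₁F₁R, and from there the game can branch:
--   F₂F₁F₁R ↦ F₃F₁R                       (move (1)), or
--   F₂F₁F₁R ↦ F₂F₂R ↦ F₁F₃R               (moves (2a), (2b)).
-- Both branches reach the multiset {F₁, F₃} ∪ R, but their third states
-- differ ({F₂,F₂} ∪ R contains no F₃).  It remains to show that this state
-- can always be played to the Zeckendorf decomposition.  For that we keep
-- the indices of a Zeckendorf decomposition as an ascending sparse list and
-- show that one more Fibonacci number F_k (k at most one above the smallest
-- index) can be absorbed by legal moves, keeping sparseness ('insert', by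
-- recursion along the list).  Absorbing the copies of F₁ one at a time
-- ('normalise') ends in a sparse list, whose reversal is the Zeckendorf
-- decomposition; moves preserve the value, so it is the decomposition of n.

open import Defs
open import Data.Nat using (ℕ; zero; suc; _+_; _<_; _≤_; z≤n; s≤s)
open import Data.Nat.Properties using (≤-refl; ≤-trans; <⇒≤; <⇒≱; n<1+n; n≤1+n; m≤m+n; m≤n+m)
open import Data.Nat.ListAction using (sum)
open import Data.Nat.ListAction.Properties using (sum-↭)
open import Data.Nat.Tactic.RingSolver using (solve-∀)
open import Data.List using (List; []; _∷_; _++_; map; replicate; reverse; reverseAcc)
open import Data.List.Relation.Binary.Permutation.Propositional
open import Data.List.Relation.Binary.Permutation.Propositional.Properties
  using (map⁺; ∈-resp-↭; ++-comm; ↭-reverse)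
open import Data.List.Relation.Binary.Pointwise using (_∷_)
open import Data.List.Relation.Unary.All using (lookup)
open import Data.List.Relation.Unary.All.Properties using (replicate⁺)
open import Data.List.Relation.Unary.Any using (here; there)
open import Data.Product using (_×_; ∃-syntax; _,_)
open import Data.Empty using (⊥-elim)
open import Relation.Nullary using (¬_)
open import Relation.Binary.PropositionalEquality
  using (_≡_; cong; sym) renaming (refl to ≡-refl; trans to ≡-trans)

sumF-↭ : ∀ {s t} → s ↭ t → sumF s ≡ sumF t
sumF-↭ {s} {t} p = ≡-trans (sumF≡sum s) (≡-trans (sum-↭ (map⁺ F p)) (sym (sumF≡sum t)))
  where
  sumF≡sum : ∀ s → sumF s ≡ sum (map F s)
  sumF≡sum []      = ≡-refl
  sumF≡sum (i ∷ s) = cong (F i +_) (sumF≡sum s)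

sumF-replicate : ∀ n → sumF (replicate n 1) ≡ n
sumF-replicate zero    = ≡-refl
sumF-replicate (suc n) = cong suc (sumF-replicate n)

-- Every legal move preserves the value: F_{i-1} + F_i = F_{i+1} and
-- 2 F_i = F_{i-2} + F_{i+1} (the latter by unfolding F twice).
sumF-move : ∀ {s t} → Move s t → sumF s ≡ sumF t
sumF-move (add i rest p q _)  = ≡-trans (sumF-↭ p) (≡-trans (merge (F i) (F (suc i)) (sumF rest)) (sym (sumF-↭ q)))
  where
  merge : ∀ a b r → a + (b + r) ≡ (b + a) + r
  merge = solve-∀
sumF-move (m2a _ p q)         = ≡-trans (sumF-↭ p) (sym (sumF-↭ q))
sumF-move (m2b _ p q)         = ≡-trans (sumF-↭ p) (sym (sumF-↭ q))
sumF-move (m2c i rest p q _)  = ≡-trans (sumF-↭ p) (≡-trans (split (F i) (F (suc i)) (sumF rest)) (sym (sumF-↭ q)))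
  where
  split : ∀ a b r → (b + a) + ((b + a) + r) ≡ a + (((b + a) + b) + r)
  split = solve-∀

data Steps : State → State → Set where
  done : ∀ {s u} → s ↭ u → Steps s u
  mv   : ∀ {s t u} → Move s t → Steps t u → Steps s u

sumF-steps : ∀ {s u} → Steps s u → sumF s ≡ sumF u
sumF-steps (done e) = sumF-↭ e
sumF-steps (mv m p) = ≡-trans (sumF-move m) (sumF-steps p)

move-resp-↭ : ∀ {s' s t} → s' ↭ s → Move s t → Move s' t
move-resp-↭ e (add i rest p q h)  = add i rest (trans e p) q h
move-resp-↭ e (m2a rest p q)      = m2a rest (trans e p) q
move-resp-↭ e (m2b rest p q)      = m2b rest (trans e p) q
move-resp-↭ e (m2c i rest p q h)  = m2c i rest (trans e p) q h

steps-resp-↭ : ∀ {s' s u} → s' ↭ s → Steps s u → Steps s' u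
steps-resp-↭ e (done e') = done (trans e e')
steps-resp-↭ e (mv m p)  = mv (move-resp-↭ e m) p

_++ˢ_ : ∀ {s t u} → Steps s t → Steps t u → Steps s u
done e ++ˢ q = steps-resp-↭ e q
mv m p ++ˢ q = mv m (p ++ˢ q)

rotate : ∀ (a b c : ℕ) r → a ∷ b ∷ c ∷ r ↭ b ∷ c ∷ a ∷ r
rotate a b c r = trans (swap a b refl) (prep b (swap a c refl))

move-cons : ∀ a {s t} → Move s t → Move (a ∷ s) (a ∷ t)
move-cons a (add i rest p q h) =
  add i (a ∷ rest) (trans (prep a p) (rotate a i (suc i) rest)) (trans (prep a q) (swap a _ refl)) h
move-cons a (m2a rest p q) =
  m2a (a ∷ rest) (trans (prep a p) (rotate a 1 1 rest)) (trans (prep a q) (swap a _ refl))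
move-cons a (m2b rest p q) =
  m2b (a ∷ rest) (trans (prep a p) (rotate a 2 2 rest)) (trans (prep a q) (rotate a 1 3 rest))
move-cons a (m2c i rest p q h) =
  m2c i (a ∷ rest) (trans (prep a p) (rotate a _ _ rest)) (trans (prep a q) (rotate a _ _ rest)) h

steps-cons : ∀ a {s u} → Steps s u → Steps (a ∷ s) (a ∷ u)
steps-cons a (done e) = done (prep a e)
steps-cons a (mv m p) = mv (move-cons a m) (steps-cons a p)

mutual
  states : ∀ {s u} → Steps s u → List State
  states {s} p = s ∷ later p

  later : ∀ {s u} → Steps s u → List State
  later (done _) = []
  later (mv _ p) = states p

states-chain : ∀ {s u} (p : Steps s u) → Chain (states p)
states-chain (done _) = one _
states-chain (mv m p) = step m (states-chain p)

states-last : ∀ {P : State → Set} {s u} (p : Steps s u) → (∀ {x} → x ↭ u → P x) → Last P (states p)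
states-last (done e) f = last (f e)
states-last (mv m p) f = more (states-last p f)

-- Sparse lo xs: xs is ascending with consecutive entries at least 2 apart
-- and all entries ≥ lo; reversed, this is a Zeckendorf decomposition.
data Sparse : ℕ → List ℕ → Set where
  []  : ∀ {lo} → Sparse lo []
  _∷_ : ∀ {lo i xs} → lo ≤ i → Sparse (suc (suc i)) xs → Sparse lo (i ∷ xs)

sparse-weaken : ∀ {lo lo' xs} → lo ≤ lo' → Sparse lo' xs → Sparse lo xs
sparse-weaken h []       = []
sparse-weaken h (l ∷ sp) = ≤-trans h l ∷ sp

-- The result of absorbing F_k into a sparse list with lower bound lo: a
-- sparse list with a positive lower bound, reached by legal moves; when
-- k < lo the bound stays ≥ k, so that a smaller index may be put in front.
record Absorbed (k lo : ℕ) (s : State) : Set where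
  constructor absorbed
  field
    {result}    : List ℕ
    bound       : ℕ
    sparse      : Sparse bound result
    bound-pos   : 1 ≤ bound
    bound-above : k < lo → k ≤ bound
    moves       : Steps s result

-- Position of the smallest index x of the list relative to the absorbed k.
data Relative : ℕ → ℕ → Set where
  one-below : ∀ x → Relative (suc x) x
  same      : ∀ k → Relative k k
  one-above : ∀ k → Relative k (suc k)
  far-above : ∀ k d → Relative k (suc (suc (k + d)))
  far-below : ∀ x d → Relative (suc (suc (x + d))) x

relative : ∀ k x → Relative k x
relative zero          zero          = same 0
relative zero          (suc zero)    = one-above 0
relative zero          (suc (suc d)) = far-above 0 d
relative (suc zero)    zero          = one-below 0
relative (suc (suc d)) zero          = far-below 0 d
relative (suc k)       (suc x) with relative k x
... | one-below x'  = one-below (suc x')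
... | same k'       = same (suc k')
... | one-above k'  = one-above (suc k')
... | far-above k' d = far-above (suc k') d
... | far-below x' d = far-below (suc x') d

after-merge : ∀ {k lo k' lo' s t} → Move s t → (r : Absorbed k' lo' t) →
  (k < lo → k ≤ Absorbed.bound r) → Absorbed k lo s
after-merge m (absorbed b sp pos _ ms) above = absorbed b sp pos above (mv m ms)

after-split : ∀ {k lo a m s xs} → Move s (a ∷ m ∷ xs) → 1 ≤ a → suc (suc a) ≤ m →
  ¬ (k < lo) → Absorbed m (suc m) (m ∷ xs) → Absorbed k lo s
after-split {a = a} {m} split-move pos-a gap not-below (absorbed _ sp _ above ms) =
  absorbed a (≤-refl ∷ sparse-weaken (≤-trans gap (above (n<1+n m))) sp) pos-a
    (λ k<lo → ⊥-elim (not-below k<lo)) (mv split-move (steps-cons a ms))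

absorb : ∀ {k lo xs} → 1 ≤ k → 1 ≤ lo → k ≤ suc lo → Sparse lo xs → Absorbed k lo (k ∷ xs)
absorb {k} hk _ _ [] = absorbed k (≤-refl ∷ []) hk (λ _ → ≤-refl) (done refl)
absorb {k} {xs = x ∷ xs} hk hlo hkl (lx ∷ sp) with relative k x
... | far-below x d = ⊥-elim (<⇒≱ (s≤s (s≤s (m≤m+n x d))) (≤-trans hkl (s≤s lx)))
... | one-below x   = after-merge (add x xs (swap (suc x) x refl) refl (≤-trans hlo lx))
                        (absorb (s≤s z≤n) (s≤s z≤n) (n≤1+n _) sp)
                        (λ k<lo → ⊥-elim (<⇒≱ (<⇒≤ k<lo) lx))
... | same zero     = ⊥-elim (<⇒≱ hk z≤n)
... | same 1        = after-merge (m2a xs refl refl) next (λ _ → Absorbed.bound-pos next)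
  where
  next : Absorbed 2 3 (2 ∷ xs)
  next = absorb (s≤s z≤n) (s≤s z≤n) (m≤n+m _ 2) sp
... | same 2        = after-split (m2b xs refl refl) ≤-refl ≤-refl (λ k<lo → <⇒≱ k<lo lx)
                        (absorb (s≤s z≤n) (s≤s z≤n) (m≤n+m _ 2) sp)
... | same (suc (suc (suc j))) =
                      after-split (m2c (suc j) xs refl refl (s≤s z≤n)) (s≤s z≤n) (n≤1+n _)
                        (λ k<lo → <⇒≱ k<lo lx) (absorb (s≤s z≤n) (s≤s z≤n) (m≤n+m _ 2) sp)
... | one-above k   = after-merge (add k xs refl refl hk) next
                        (λ _ → <⇒≤ (<⇒≤ (Absorbed.bound-above next (n<1+n _))))
  where
  next : Absorbed (suc (suc k)) (suc (suc (suc k))) (suc (suc k) ∷ xs)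
  next = absorb (s≤s z≤n) (s≤s z≤n) (m≤n+m _ 2) sp
... | far-above k d = absorbed k (≤-refl ∷ (s≤s (s≤s (m≤m+n k d)) ∷ sp)) hk (λ _ → ≤-refl) (done refl)

normalise : ∀ k {xs} → Sparse 1 xs → ∃[ ys ] (Sparse 1 ys × Steps (replicate k 1 ++ xs) ys)
normalise zero sp = _ , sp , done refl
normalise (suc k) sp with normalise k sp
... | ys , sp' , ms with absorb ≤-refl ≤-refl (n≤1+n 1) sp'
...   | absorbed _ sp'' pos _ ms' = _ , sparse-weaken pos sp'' , (steps-cons 1 ms ++ˢ ms')

-- Reversing a sparse list gives a Zeckendorf decomposition.  The
-- accumulator holds an already reversed part whose largest entry is at
-- least 2 below every remaining entry.
data DescBelow (lo : ℕ) : List ℕ → Set where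
  []  : DescBelow lo []
  top : ∀ {j r} → suc (suc j) ≤ lo → NonAdjDesc (j ∷ r) → DescBelow lo (j ∷ r)

reverseAcc-nonAdj : ∀ {lo acc xs} → 1 ≤ lo → Sparse lo xs → DescBelow lo acc →
  NonAdjDesc (reverseAcc acc xs)
reverseAcc-nonAdj _  []        []          = []
reverseAcc-nonAdj _  []        (top _ d)   = d
reverseAcc-nonAdj hlo (l ∷ sp) []          = reverseAcc-nonAdj (s≤s z≤n) sp (top ≤-refl [ ≤-trans hlo l ])
reverseAcc-nonAdj hlo (l ∷ sp) (top g d)   = reverseAcc-nonAdj (s≤s z≤n) sp (top ≤-refl (≤-trans g l ∷ d))

game : ∀ n {u} (p : Steps (replicate n 1) u) → Sparse 1 u → Game n (states p)
game n {u} p sp = states-chain p , here refl , states-last p reaches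
  where
  value : sumF (reverse u) ≡ n
  value = ≡-trans (sumF-↭ (↭-reverse u)) (≡-trans (sym (sumF-steps p)) (sumF-replicate n))

  reaches : ∀ {x} → x ↭ u → ∃[ z ] (IsZeckendorf z n × x ↭ z)
  reaches e = reverse u , (reverseAcc-nonAdj ≤-refl sp [] , value) , trans e (↭-sym (↭-reverse u))

F₂F₂≁F₃F₁ : ∀ k → ¬ (2 ∷ 2 ∷ replicate k 1 ↭ 3 ∷ 1 ∷ replicate k 1)
F₂F₂≁F₃F₁ k e with ∈-resp-↭ (↭-sym e) (here ≡-refl)
... | here ()
... | there (here ())
... | there (there 3∈R) with lookup (replicate⁺ {P = _≡ 1} k ≡-refl) 3∈R
...   | ()

lemma2p2 : (n : ℕ) → 3 < n →
    ∃[ g₁ ] ∃[ g₂ ] (Game n g₁ × Game n g₂ × ¬ SameGame g₁ g₂)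
lemma2p2 _ (s≤s (s≤s (s≤s (s≤s (z≤n {k}))))) with normalise k (≤-refl ∷ (≤-refl ∷ []))
... | ys , sp , finish = states viaF₂F₂ , states viaF₃ , game _ viaF₂F₂ sp , game _ viaF₃ sp , differ
  where
  R : State
  R = replicate k 1
  toF₂F₁F₁ : Move (1 ∷ 1 ∷ 1 ∷ 1 ∷ R) (2 ∷ 1 ∷ 1 ∷ R)
  toF₂F₁F₁ = m2a (1 ∷ 1 ∷ R) refl refl
  fromF₁F₃ : ∀ {s} → s ↭ 1 ∷ 3 ∷ R → Steps s ys
  fromF₁F₃ e = steps-resp-↭ (trans e (++-comm (1 ∷ 3 ∷ []) R)) finish
  viaF₃ viaF₂F₂ : Steps (1 ∷ 1 ∷ 1 ∷ 1 ∷ R) ys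
  viaF₃   = mv toF₂F₁F₁ (mv (add 1 (1 ∷ R) (swap 2 1 refl) refl ≤-refl) (fromF₁F₃ (swap 3 1 refl)))
  viaF₂F₂ = mv toF₂F₁F₁ (mv (m2a (2 ∷ R) (rotate 2 1 1 R) refl) (mv (m2b R refl refl) (fromF₁F₃ refl)))
  differ : ¬ SameGame (states viaF₂F₂) (states viaF₃)
  differ (_ ∷ _ ∷ third ∷ _) = F₂F₂≁F₃F₁ k third
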